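{- Let $\mathcal{P}$ be a finite poset with at least two elements that has the Unique Cover Twin Property. Then for every positive integer $n$, $\lceil \log_2 n\rceil \leq \mathrm{sat}^*(n,\mathcal{P})$.
   Context: In a poset, $y$ covers $x$ if $x<y$ and there is no $z$ with $x<z<y$. A poset $\mathcal{P}=(P,\le)$ has the Unique Cover Twin Property (UCTP) if for every element $S\in P$ that has precisely one cover $T\in P$, there exists $S'\in P$, $S'\neq S$, such that $T$ also covers $S'$. $\mathcal{B}_n$ is the Boolean lattice $(2^{[n]},\subseteq)$. A poset $\mathcal{P}'=(P',\le')$ is an induced subposet of $\mathcal{P}=(P,\le)$ if there is an injection $f:P'\to P$ with $u\le' v$ iff $f(u)\le f(v)$. A family $\mathcal{F}\subseteq 2^{[n]}$ (ordered by inclusion) is induced-$\mathcal{P}$-saturated in $\mathcal{B}_n$ if it contains no induced copy of $\mathcal{P}$, but every $\mathcal{F}'$ with $\mathcal{F}\subsetneq\mathcal{F}'\subseteq 2^{[n]}$ contains an induced copy of $\mathcal{P}$. $\mathrm{sat}^*(n,\mathcal{P})$ is the minimum size of an induced-$\mathcal{P}$-saturated family in $\mathcal{B}_n$ (equal to $2^n$ if $\mathcal{P}$ is not an induced subposet of $\mathcal{B}_n$). -}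

module Defs where

open import Level using (0ℓ)
open import Data.Nat using (ℕ; zero; suc; _≤_)
open import Data.Bool using (Bool; true; false; T)
open import Data.Fin using (Fin)
open import Data.Fin.Subset using (Subset; Side; inside; outside; _⊆_)
open import Data.Vec using (_∷_; [])
open import Data.List using (List; []; _∷_; map; _++_; filter; length)
open import Data.Product using (Σ; ∃; ∃-syntax; _×_; _,_)
open import Data.Empty using (⊥)
open import Function using (_⇔_)
open import Function.Definitions using (Injective)
open import Relation.Nullary using (¬_)
open import Relation.Binary.PropositionalEquality using (_≡_; _≢_)
open import Relation.Binary.Structures using (IsPartialOrder)
open import Relation.Unary using (Pred)
open import Data.Bool.Properties using (T?)

record FinPoset : Set₁ where
  field
    size : ℕ
    _≼_ : Fin size → Fin size → Set
    isPartialOrder : IsPartialOrder _≡_ _≼_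

module _ (P : FinPoset) where
  open FinPoset P

  _≺_ : Fin size → Fin size → Set
  x ≺ y = x ≼ y × x ≢ y

  Covers : Fin size → Fin size → Set
  Covers x y = x ≺ y × ¬ (∃[ z ] (x ≺ z × z ≺ y))

  UCTP : Set
  UCTP = ∀ (S T : Fin size) →
         Covers S T →
         (∀ T' → Covers S T' → T' ≡ T) →
         ∃[ S' ] (S' ≢ S × Covers S' T)

Family : ℕ → Set
Family n = Subset n → Bool

_∈F_ : ∀ {n} → Subset n → Family n → Set
S ∈F F = T (F S)

allSubsets : (n : ℕ) → List (Subset n)
allSubsets zero = [] ∷ []
allSubsets (suc n) = map (inside ∷_) (allSubsets n) ++ map (outside ∷_) (allSubsets n)

∣_∣F : ∀ {n} → Family n → ℕ
∣_∣F {n} F = length (filter (λ S → T? (F S)) (allSubsets n))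

module _ (P : FinPoset) where
  open FinPoset P

  ContainsInducedCopy : ∀ {n} → Family n → Set
  ContainsInducedCopy {n} F =
    Σ (Fin size → Subset n) λ f →
      Injective _≡_ _≡_ f ×
      (∀ u → f u ∈F F) ×
      (∀ u v → (u ≼ v) ⇔ (f u ⊆ f v))

  InducedSaturated : ∀ {n} → Family n → Set
  InducedSaturated {n} F =
    ¬ ContainsInducedCopy F ×
    (∀ (F' : Family n) →
       (∀ S → S ∈F F → S ∈F F') →
       (∃[ S ] (S ∈F F' × ¬ (S ∈F F))) →
       ContainsInducedCopy F')

-- An induced-P-saturated family F separates the points of [n], and separating n points takes
-- at least ⌈log₂ n⌉ sets. Suppose no member of F distinguishes i ≠ j. Take either a minimal
-- C ∈ F containing i (hence j) and A = C ∖ {j}, or, if no member contains i, a maximal X ∈ F and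
-- A = X ∪ {i}. Then A ∉ F, A is comparable with C (resp. X), and the two relate identically to all
-- other members of F. Adding A creates an induced copy of P through A. If the copy avoids C (X),
-- putting it in place of A yields a copy inside F; otherwise the two corresponding elements of P
-- form a cover in which each is the other's only neighbour, contradicting the UCTP.
module Submission where

open import Defs
open import Data.Nat using (ℕ; suc; _≤_; _^_; _∸_)
open import Data.Nat.Logarithm using (⌈log₂_⌉; ⌈log₂⌉-mono-≤; ⌈log₂2^n⌉≡n)
open import Data.Nat.Properties using (∸-monoʳ-<)
open import Data.Nat.Induction using (<-wellFounded)
open import Data.Bool using (Bool; _∨_)
open import Data.Bool.Properties using (T?) renaming (_≟_ to _≟B_)
open import Data.Fin using (Fin) renaming (_≟_ to _≟F_)
import Data.Fin as Fin
open import Data.Fin.Base using (funToFin; finToFun)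
open import Data.Fin.Properties using (2↔Bool; finToFun-funToFin; injective⇒≤; <⇒notInjective; any?)
open import Data.Fin.Subset using (Subset; inside; outside; _∈_; _∉_; _⊆_; _⊂_; _⊃_; _-_; _─_; _∪_; ⁅_⁆; ∣_∣) renaming (⊥ to ∅)
open import Data.Fin.Subset.Properties
  using (_∈?_; anySubset?; ⊆-trans; ⊆-antisym; p⊂q⇒∣p∣<∣q∣; ∣p∣≤n; p─q⊆p; x∈p∧x≢y⇒x∈p-y;
         p⊆p∪q; x∈p∪q⁻; x∈⁅y⁆⇒x≡y; x∈⁅x⁆; q⊆p∪q)
open import Data.Vec using ([]; _∷_; lookup; here; there)
open import Data.Vec.Properties using (≡-dec; []=⇒lookup; lookup⇒[]=)
open import Data.List using (List; map; filter; length)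
import Data.List as List
open import Data.List.Membership.Propositional using () renaming (_∈_ to _∈ₗ_)
open import Data.List.Membership.Propositional.Properties using (∈-map⁺; ∈-++⁺ˡ; ∈-++⁺ʳ; ∈-filter⁺)
open import Data.List.Relation.Unary.Any using (here; index)
open import Data.List.Relation.Unary.Any.Properties using (lookup-index)
open import Data.Product using (∃-syntax; _×_; _,_; proj₁; proj₂)
open import Data.Sum using (_⊎_; inj₁; inj₂; [_,_]′)
open import Data.Empty using (⊥-elim)
open import Function using (_⇔_; _∘_; id; Inverse)
open import Function.Bundles using (Equivalence; mk⇔)
open import Function.Definitions using (Injective)
import Function.Properties.Equivalence as ⇔
open import Induction.WellFounded using (WellFounded; module All; module Subrelation)
open import Relation.Binary.Construct.On as On using ()
open import Relation.Binary.Core using (Rel)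
open import Relation.Binary.Definitions using (DecidableEquality)
open import Relation.Binary.Structures using (IsPartialOrder)
open import Relation.Binary.PropositionalEquality using (_≡_; _≢_; refl; sym; trans; cong; subst; ≢-sym; module ≡-Reasoning)
open import Relation.Nullary using (¬_; yes; no; does; contradiction)
open import Relation.Nullary.Decidable using (decidable-stable; _×-dec_)
open import Relation.Unary using (Pred)

SeparatesPoints : ∀ {n} → Family n → Set
SeparatesPoints {n} F = ∀ (i j : Fin n) → (∀ S → S ∈F F → lookup S i ≡ lookup S j) → i ≡ j

funToFin-injective : ∀ {m k} {f g : Fin m → Fin k} → funToFin f ≡ funToFin g → ∀ x → f x ≡ g x
funToFin-injective {f = f} {g} eq x = begin
  f x                     ≡⟨ finToFun-funToFin f x ⟨
  finToFun (funToFin f) x ≡⟨ cong (λ c → finToFun c x) eq ⟩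
  finToFun (funToFin g) x ≡⟨ finToFun-funToFin g x ⟩
  g x                     ∎
  where open ≡-Reasoning

bit : Bool → Fin 2
bit = Inverse.from 2↔Bool

bit-injective : Injective _≡_ _≡_ bit
bit-injective {b} {c} eq = begin
  b                 ≡⟨ Inverse.strictlyInverseˡ 2↔Bool b ⟨
  to (bit b)        ≡⟨ cong to eq ⟩
  to (bit c)        ≡⟨ Inverse.strictlyInverseˡ 2↔Bool c ⟩
  c                 ∎
  where
    open ≡-Reasoning
    to = Inverse.to 2↔Bool

separatingList⇒≤2^length : ∀ {n} (L : List (Subset n)) →
  (∀ i j → (∀ {S} → S ∈ₗ L → lookup S i ≡ lookup S j) → i ≡ j) →
  n ≤ 2 ^ length L
separatingList⇒≤2^length {n} L separates = injective⇒≤ code-injective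
  where
    -- the membership pattern of a point in the sets of L, as a binary number
    code : Fin n → Fin (2 ^ length L)
    code i = funToFin (λ k → bit (lookup (List.lookup L k) i))

    code-injective : Injective _≡_ _≡_ code
    code-injective {i} {j} eq = separates i j λ S∈L →
      subst (λ S → lookup S i ≡ lookup S j) (sym (lookup-index S∈L))
            (bit-injective (funToFin-injective eq (index S∈L)))

∈-allSubsets : ∀ {n} (S : Subset n) → S ∈ₗ allSubsets n
∈-allSubsets [] = here refl
∈-allSubsets (inside ∷ S) = ∈-++⁺ˡ (∈-map⁺ (inside ∷_) (∈-allSubsets S))
∈-allSubsets {suc n} (outside ∷ S) =
  ∈-++⁺ʳ (map (inside ∷_) (allSubsets n)) (∈-map⁺ (outside ∷_) (∈-allSubsets S))

separating⇒⌈log₂⌉≤size : ∀ {n} (F : Family n) → SeparatesPoints F → ⌈log₂ n ⌉ ≤ ∣ F ∣F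
separating⇒⌈log₂⌉≤size {n} F separates =
  subst (⌈log₂ n ⌉ ≤_) (⌈log₂2^n⌉≡n _) (⌈log₂⌉-mono-≤ (separatingList⇒≤2^length members separates′))
  where
    members : List (Subset n)
    members = filter (λ S → T? (F S)) (allSubsets n)

    separates′ : ∀ i j → (∀ {S} → S ∈ₗ members → lookup S i ≡ lookup S j) → i ≡ j
    separates′ i j agree = separates i j λ S S∈F →
      agree (∈-filter⁺ (λ S → T? (F S)) (∈-allSubsets S) S∈F)

no-minimal⇒empty : ∀ {a r q} {A : Set a} {_<_ : Rel A r} → WellFounded _<_ → (Q : Pred A q) →
  (∀ x → Q x → ¬ (∀ y → y < x → ¬ Q y)) → ∀ x → ¬ Q x
no-minimal⇒empty wf Q no-minimal =
  All.wfRec wf _ (λ x → ¬ Q x) (λ x smaller-absent Qx → no-minimal x Qx (λ _ → smaller-absent))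

⊂-wellFounded : ∀ {n} → WellFounded (_⊂_ {n})
⊂-wellFounded = Subrelation.wellFounded p⊂q⇒∣p∣<∣q∣ (On.wellFounded ∣_∣ <-wellFounded)

⊃-wellFounded : ∀ {n} → WellFounded (_⊃_ {n})
⊃-wellFounded {n} =
  Subrelation.wellFounded (λ {p} q⊂p → ∸-monoʳ-< (p⊂q⇒∣p∣<∣q∣ q⊂p) (∣p∣≤n p))
                          (On.wellFounded (λ p → n ∸ ∣ p ∣) <-wellFounded)

⊆∧⊄⇒≡ : ∀ {n} {p q : Subset n} → p ⊆ q → ¬ p ⊂ q → p ≡ q
⊆∧⊄⇒≡ {p = p} p⊆q p⊄q = ⊆-antisym p⊆q λ {x} x∈q →
  decidable-stable (x ∈? p) (λ x∉p → p⊄q (p⊆q , x , x∈q , x∉p))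

x∈p─q⇒x∉q : ∀ {n} (p q : Subset n) {x} → x ∈ p ─ q → x ∉ q
x∈p─q⇒x∉q (_ ∷ p) (outside ∷ q) here ()
x∈p─q⇒x∉q (_ ∷ p) (_ ∷ q) (there x∈p─q) (there x∈q) = x∈p─q⇒x∉q p q x∈p─q x∈q

x∉p-x : ∀ {n} (p : Subset n) x → x ∉ p - x
x∉p-x p x x∈p-x = x∈p─q⇒x∉q p ⁅ x ⁆ x∈p-x (x∈⁅x⁆ x)

∈-transfer : ∀ {n} {S : Subset n} {x y} → lookup S x ≡ lookup S y → x ∈ S → y ∈ S
∈-transfer {S = S} {x} {y} eq x∈S = lookup⇒[]= y S (trans (sym eq) ([]=⇒lookup x∈S))

_≟ₛ_ : ∀ {n} → DecidableEquality (Subset n)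
_≟ₛ_ = ≡-dec _≟B_

insert : ∀ {n} → Subset n → Family n → Family n
insert A F S = does (S ≟ₛ A) ∨ F S

module _ {n} (F : Family n) where

  ∈-insert⁻ : ∀ {A S} → S ∈F insert A F → S ≡ A ⊎ S ∈F F
  ∈-insert⁻ {A} {S} S∈ with S ≟ₛ A
  ... | yes S≡A = inj₁ S≡A
  ... | no _ = inj₂ S∈

  ∈-insert-new : ∀ A → A ∈F insert A F
  ∈-insert-new A with A ≟ₛ A
  ... | yes _ = _
  ... | no A≢A = contradiction refl A≢A

  ∈-insert-old : ∀ A S → S ∈F F → S ∈F insert A F
  ∈-insert-old A S S∈F with S ≟ₛ A
  ... | yes _ = _
  ... | no _ = S∈F

TwinsIn : ∀ {n} → Family n → Subset n → Subset n → Set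
TwinsIn F A Y = ∀ S → S ∈F F → S ≢ A → S ≢ Y → (S ⊆ A ⇔ S ⊆ Y) × (A ⊆ S ⇔ Y ⊆ S)

module Swap {n} (F : Family n) (A Y : Subset n) where

  swap : Subset n → Subset n
  swap S with S ≟ₛ A
  ... | yes _ = Y
  ... | no _ = S

  data Swapped : Subset n → Subset n → Set where
    swapped : Swapped A Y
    kept    : ∀ {S} → S ∈F F → S ≢ A → S ≢ Y → Swapped S S

  swapped-view : ∀ {S} → S ∈F insert A F → S ≢ Y → Swapped S (swap S)
  swapped-view {S} S∈ S≢Y with S ≟ₛ A
  ... | yes refl = swapped
  ... | no S≢A = kept S∈ S≢A S≢Y

  swapped-∈ : ∀ {S S′} → Y ∈F F → Swapped S S′ → S′ ∈F F
  swapped-∈ Y∈F swapped = Y∈F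
  swapped-∈ Y∈F (kept S∈F _ _) = S∈F

  swapped-injective : ∀ {S S′ T T′} → Swapped S S′ → Swapped T T′ → S′ ≡ T′ → S ≡ T
  swapped-injective swapped swapped _ = refl
  swapped-injective swapped (kept _ _ T≢Y) Y≡T = contradiction (sym Y≡T) T≢Y
  swapped-injective (kept _ _ S≢Y) swapped S≡Y = contradiction S≡Y S≢Y
  swapped-injective (kept _ _ _) (kept _ _ _) S≡T = S≡T

  swapped-⊆ : ∀ {S S′ T T′} → TwinsIn F A Y → Swapped S S′ → Swapped T T′ → (S ⊆ T) ⇔ (S′ ⊆ T′)
  swapped-⊆ _ swapped swapped = mk⇔ (λ _ {_} x∈Y → x∈Y) (λ _ {_} x∈A → x∈A)
  swapped-⊆ twins swapped (kept T∈F T≢A T≢Y) = proj₂ (twins _ T∈F T≢A T≢Y)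
  swapped-⊆ twins (kept S∈F S≢A S≢Y) swapped = proj₁ (twins _ S∈F S≢A S≢Y)
  swapped-⊆ _ (kept _ _ _) (kept _ _ _) = ⇔.refl

module _ {n} (F : Family n) where

  removal-twin : ∀ {i j C} → i ≢ j → (∀ S → S ∈F F → lookup S i ≡ lookup S j) →
    C ∈F F → i ∈ C → (∀ S → S ∈F F → i ∈ S → ¬ S ⊂ C) →
    ¬ (C - j) ∈F F × C - j ⊆ C × TwinsIn F (C - j) C
  removal-twin {i} {j} {C} i≢j agree C∈F i∈C minimal = A∉F , A⊆C , twins
    where
      A : Subset n
      A = C - j

      A⊆C : A ⊆ C
      A⊆C = p─q⊆p C ⁅ j ⁆

      i∈A : i ∈ A
      i∈A = x∈p∧x≢y⇒x∈p-y i∈C i≢j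

      A∉F : ¬ A ∈F F
      A∉F A∈F = x∉p-x C j (∈-transfer (agree A A∈F) i∈A)

      twins : TwinsIn F A C
      twins S S∈F _ S≢C = mk⇔ S⊆A⇒S⊆C S⊆C⇒S⊆A , mk⇔ A⊆S⇒C⊆S C⊆S⇒A⊆S
        where
          S⊆A⇒S⊆C : S ⊆ A → S ⊆ C
          S⊆A⇒S⊆C S⊆A = ⊆-trans S⊆A A⊆C

          C⊆S⇒A⊆S : C ⊆ S → A ⊆ S
          C⊆S⇒A⊆S = ⊆-trans A⊆C

          S⊆C⇒S⊆A : S ⊆ C → S ⊆ A
          S⊆C⇒S⊆A S⊆C {x} x∈S =
            x∈p∧x≢y⇒x∈p-y (S⊆C x∈S) λ { refl → i∉S (∈-transfer (sym (agree S S∈F)) x∈S) }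
            where
              i∉S : i ∉ S
              i∉S i∈S = S≢C (⊆∧⊄⇒≡ S⊆C (minimal S S∈F i∈S))

          A⊆S⇒C⊆S : A ⊆ S → C ⊆ S
          A⊆S⇒C⊆S A⊆S {x} x∈C with x ≟F j
          ... | yes refl = ∈-transfer (agree S S∈F) (A⊆S i∈A)
          ... | no x≢j = A⊆S (x∈p∧x≢y⇒x∈p-y x∈C x≢j)

  insertion-twin : ∀ {i X} → (∀ S → S ∈F F → i ∉ S) → X ∈F F → (∀ S → S ∈F F → ¬ X ⊂ S) →
    ¬ (X ∪ ⁅ i ⁆) ∈F F × X ⊆ X ∪ ⁅ i ⁆ × TwinsIn F (X ∪ ⁅ i ⁆) X
  insertion-twin {i} {X} i-nowhere X∈F maximal = A∉F , X⊆A , twins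
    where
      A : Subset n
      A = X ∪ ⁅ i ⁆

      X⊆A : X ⊆ A
      X⊆A = p⊆p∪q ⁅ i ⁆

      A∉F : ¬ A ∈F F
      A∉F A∈F = i-nowhere A A∈F (q⊆p∪q X ⁅ i ⁆ (x∈⁅x⁆ i))

      twins : TwinsIn F A X
      twins S S∈F _ S≢X = mk⇔ S⊆A⇒S⊆X S⊆X⇒S⊆A , mk⇔ A⊆S⇒X⊆S X⊆S⇒A⊆S
        where
          S⊆X⇒S⊆A : S ⊆ X → S ⊆ A
          S⊆X⇒S⊆A S⊆X = ⊆-trans S⊆X X⊆A

          A⊆S⇒X⊆S : A ⊆ S → X ⊆ S
          A⊆S⇒X⊆S = ⊆-trans X⊆A

          X⊆S⇒A⊆S : X ⊆ S → A ⊆ S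
          X⊆S⇒A⊆S X⊆S = contradiction (sym (⊆∧⊄⇒≡ X⊆S (maximal S S∈F))) S≢X

          S⊆A⇒S⊆X : S ⊆ A → S ⊆ X
          S⊆A⇒S⊆X S⊆A {x} x∈S with x∈p∪q⁻ X ⁅ i ⁆ (S⊆A x∈S)
          ... | inj₁ x∈X = x∈X
          ... | inj₂ x∈⁅i⁆ = contradiction (subst (_∈ S) (x∈⁅y⁆⇒x≡y i x∈⁅i⁆) x∈S) (i-nowhere S S∈F)

module _ (P : FinPoset) where
  open FinPoset P
  open IsPartialOrder isPartialOrder using (antisym) renaming (refl to ≼-refl)

  Twins : Fin size → Fin size → Set
  Twins a b = ∀ v → v ≢ a → v ≢ b → (a ≼ v ⇔ b ≼ v) × (v ≼ a ⇔ v ≼ b)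

  Twins-sym : ∀ {a b} → Twins a b → Twins b a
  Twins-sym twins v v≢b v≢a = ⇔.sym (proj₁ (twins v v≢a v≢b)) , ⇔.sym (proj₂ (twins v v≢a v≢b))

  -- b is then the unique cover of a, and a is the only element b covers.
  UCTP⇒¬≺-twins : UCTP P → ∀ {a b} → a ≼ b → a ≢ b → ¬ Twins a b
  UCTP⇒¬≺-twins uctp {a} {b} a≼b a≢b twins =
    no-other-covered-by-b (uctp a b b-covers-a only-b-covers-a)
    where
      above : ∀ {v} → a ≼ v → a ≢ v → b ≼ v
      above {v} a≼v a≢v with v ≟F b
      ... | yes refl = ≼-refl
      ... | no v≢b = Equivalence.to (proj₁ (twins v (≢-sym a≢v) v≢b)) a≼v

      below : ∀ {v} → v ≼ b → v ≢ b → v ≼ a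
      below {v} v≼b v≢b with v ≟F a
      ... | yes refl = ≼-refl
      ... | no v≢a = Equivalence.from (proj₂ (twins v v≢a v≢b)) v≼b

      b-covers-a : Covers P a b
      b-covers-a = (a≼b , a≢b) , λ { (z , (a≼z , a≢z) , (z≼b , z≢b)) →
                                       z≢b (antisym z≼b (above a≼z a≢z)) }

      only-b-covers-a : ∀ c → Covers P a c → c ≡ b
      only-b-covers-a c ((a≼c , a≢c) , nothing-between) with c ≟F b
      ... | yes c≡b = c≡b
      ... | no c≢b = ⊥-elim (nothing-between (b , (a≼b , a≢b) , (above a≼c a≢c , ≢-sym c≢b)))

      no-other-covered-by-b : ¬ (∃[ a′ ] (a′ ≢ a × Covers P a′ b))
      no-other-covered-by-b (a′ , a′≢a , (a′≼b , a′≢b) , nothing-between) =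
        nothing-between (a , (below a′≼b a′≢b , a′≢a) , (a≼b , a≢b))

  IsInducedCopyIn : ∀ {n} → Family n → (Fin size → Subset n) → Set
  IsInducedCopyIn G f = Injective _≡_ _≡_ f × (∀ u → f u ∈F G) × (∀ u v → (u ≼ v) ⇔ (f u ⊆ f v))

  module _ {n} {F : Family n} where

    swap-copy : ∀ {A Y f} → Y ∈F F → TwinsIn F A Y → IsInducedCopyIn (insert A F) f →
      (∀ u → f u ≢ Y) → IsInducedCopyIn F (Swap.swap F A Y ∘ f)
    swap-copy {A} {Y} {f} Y∈F twins (f-injective , f-in , f-iso) Y∉f =
      (λ {u} {v} eq → f-injective (swapped-injective (view u) (view v) eq)) ,
      (λ u → swapped-∈ Y∈F (view u)) ,
      (λ u v → ⇔.trans (f-iso u v) (swapped-⊆ twins (view u) (view v)))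
      where
        open Swap F A Y

        view : ∀ u → Swapped (f u) (swap (f u))
        view u = swapped-view (f-in u) (Y∉f u)

    copy-twins : ∀ {f u w} → IsInducedCopyIn (insert (f u) F) f → TwinsIn F (f u) (f w) → Twins u w
    copy-twins {f} {u} {w} (f-injective , f-in , f-iso) twins v v≢u v≢w =
      ⇔.trans (f-iso u v) (⇔.trans (proj₂ related) (⇔.sym (f-iso w v))) ,
      ⇔.trans (f-iso v u) (⇔.trans (proj₁ related) (⇔.sym (f-iso v w)))
      where
        fv∈F : f v ∈F F
        fv∈F = [ (λ fv≡fu → contradiction (f-injective fv≡fu) v≢u) , id ]′ (∈-insert⁻ F (f-in v))

        related : (f v ⊆ f u ⇔ f v ⊆ f w) × (f u ⊆ f v ⇔ f w ⊆ f v)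
        related = twins (f v) fv∈F (v≢u ∘ f-injective) (v≢w ∘ f-injective)

  module _ {n} {F : Family n} (saturated : InducedSaturated P F) where

    copy-through : ∀ {A} → ¬ A ∈F F → ∃[ f ] IsInducedCopyIn (insert A F) f × ∃[ u ] f u ≡ A
    copy-through {A} A∉F
      with proj₂ saturated (insert A F) (∈-insert-old F A) (A , ∈-insert-new F A , A∉F)
    ... | f , copy@(f-injective , f-in , f-iso) with any? (λ u → f u ≟ₛ A)
    ...   | yes A∈f = f , copy , A∈f
    ...   | no A∉f = ⊥-elim (proj₁ saturated (f , f-injective , f-in′ , f-iso))
      where
        f-in′ : ∀ u → f u ∈F F
        f-in′ u = [ (λ fu≡A → contradiction (u , fu≡A) A∉f) , id ]′ (∈-insert⁻ F (f-in u))

    comparable-twin-absent : UCTP P → ∀ {A Y} → Y ∈F F → ¬ A ∈F F → A ⊆ Y ⊎ Y ⊆ A → ¬ TwinsIn F A Y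
    comparable-twin-absent uctp {A} {Y} Y∈F A∉F comparable twins with copy-through A∉F
    ... | f , copy , u , refl with any? (λ w → f w ≟ₛ Y)
    ...   | no Y∉f = proj₁ saturated (_ , swap-copy Y∈F twins copy (λ w fw≡Y → Y∉f (w , fw≡Y)))
    ...   | yes (w , refl) = [ ¬fu⊆fw , ¬fw⊆fu ]′ comparable
      where
        f-iso : ∀ u v → (u ≼ v) ⇔ (f u ⊆ f v)
        f-iso = proj₂ (proj₂ copy)

        u≢w : u ≢ w
        u≢w u≡w = A∉F (subst (_∈F F) (cong f (sym u≡w)) Y∈F)

        uw-twins : Twins u w
        uw-twins = copy-twins copy twins

        ¬fu⊆fw : ¬ f u ⊆ f w
        ¬fu⊆fw fu⊆fw = UCTP⇒¬≺-twins uctp (Equivalence.from (f-iso u w) fu⊆fw) u≢w uw-twins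

        ¬fw⊆fu : ¬ f w ⊆ f u
        ¬fw⊆fu fw⊆fu =
          UCTP⇒¬≺-twins uctp (Equivalence.from (f-iso w u) fw⊆fu) (≢-sym u≢w) (Twins-sym uw-twins)

    saturated⇒nonempty : 2 ≤ size → ∃[ S ] S ∈F F
    saturated⇒nonempty 2≤size with anySubset? (λ S → T? (F S))
    ... | yes F-nonempty = F-nonempty
    ... | no F-empty with copy-through {∅} (λ ∅∈F → F-empty (∅ , ∅∈F))
    ...   | f , (f-injective , f-in , _) , _ =
      ⊥-elim (<⇒notInjective {f = λ _ → Fin.zero} 2≤size λ {u} {v} _ →
                f-injective (trans (f≡∅ u) (sym (f≡∅ v))))
      where
        f≡∅ : ∀ u → f u ≡ ∅
        f≡∅ u = [ id , (λ fu∈F → ⊥-elim (F-empty (f u , fu∈F))) ]′ (∈-insert⁻ F (f-in u))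

    saturated⇒separating : 2 ≤ size → UCTP P → SeparatesPoints F
    saturated⇒separating 2≤size uctp i j agree with i ≟F j
    ... | yes i≡j = i≡j
    ... | no i≢j with anySubset? (λ S → T? (F S) ×-dec (i ∈? S))
    ...   | yes (C , C∈F , i∈C) =
      ⊥-elim (no-minimal⇒empty ⊂-wellFounded (λ S → S ∈F F × i ∈ S) no-minimal C (C∈F , i∈C))
      where
        no-minimal : ∀ C → C ∈F F × i ∈ C → ¬ (∀ S → S ⊂ C → ¬ (S ∈F F × i ∈ S))
        no-minimal C (C∈F , i∈C) minimal =
          let (A∉F , A⊆C , twins) = removal-twin F i≢j agree C∈F i∈C
                                      λ S S∈F i∈S S⊂C → minimal S S⊂C (S∈F , i∈S)
          in comparable-twin-absent uctp C∈F A∉F (inj₁ A⊆C) twins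
    ...   | no i-nowhere =
      let (X , X∈F) = saturated⇒nonempty 2≤size
      in ⊥-elim (no-minimal⇒empty ⊃-wellFounded (_∈F F) no-maximal X X∈F)
      where
        no-maximal : ∀ X → X ∈F F → ¬ (∀ S → X ⊂ S → ¬ S ∈F F)
        no-maximal X X∈F maximal =
          let (A∉F , X⊆A , twins) = insertion-twin F (λ S S∈F i∈S → i-nowhere (S , S∈F , i∈S)) X∈F
                                      λ S S∈F X⊂S → maximal S X⊂S S∈F
          in comparable-twin-absent uctp X∈F A∉F (inj₂ X⊆A) twins

theorem9 : (P : FinPoset) → 2 ≤ FinPoset.size P → UCTP P →
    ∀ (n : ℕ) → 1 ≤ n →
    ∀ (F : Family n) → InducedSaturated P F →
    ⌈log₂ n ⌉ ≤ ∣ F ∣F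
theorem9 P 2≤size uctp n _ F saturated =
  separating⇒⌈log₂⌉≤size F (saturated⇒separating P saturated 2≤size uctp)
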